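{- Let $n$ and $m$ be integers such that $m\geq 3$ and $n\geq \frac{m^2}{2}-3$. Then $\gamma^{\mathrm{ID}}_{D}(\mathcal P_{m,n})\leq \left\lceil\frac{n}{2}\right\rceil+m-1$.
   Context: For integers $m,n\geq1$, $\mathcal P_{m,n}$ denotes the set of points $(x,y)\in\mathbb Z^2$ with $1\leq y\leq m$ and $1\leq x\leq n$ (so $m$ rows and $n$ columns). A disk of radius $r>0$ and center $c\in\mathbb R^2$ is the set of points of $\mathbb R^2$ at Euclidean distance at most $r$ from $c$. A point is covered by a disk if it belongs to it; two points are separated by a disk if exactly one of them is covered by it. A set $\mathcal D$ of disks identifies a finite set $\mathcal P\subseteq\mathbb R^2$ if every point of $\mathcal P$ is covered by some disk of $\mathcal D$ and every pair of distinct points of $\mathcal P$ is separated by some disk of $\mathcal D$. $\gamma^{\mathrm{ID}}_{D}(\mathcal P)$ denotes the minimum number of disks (of arbitrary radii) in a set identifying $\mathcal P$. -}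

module Defs where

open import Data.Nat using (ℕ; _≤_)
open import Data.Integer using (+_)
open import Data.Rational as ℚ using (ℚ; 0ℚ; _+_; _*_; _-_; _/_)
open import Data.Product using (_×_; _,_)
open import Data.Sum using (_⊎_)
open import Data.List using (List)
open import Data.List.Relation.Unary.Any using (Any)
open import Relation.Nullary using (¬_)
open import Relation.Binary.PropositionalEquality using (_≡_)

Point : Set
Point = ℕ × ℕ

toℚ : ℕ → ℚ
toℚ k = (+ k) / 1

record Disk : Set where
  constructor disk
  field
    cx  : ℚ
    cy  : ℚ
    r   : ℚ
    r>0 : 0ℚ ℚ.< r

Covers : Disk → Point → Set
Covers d (x , y) =
  ((toℚ x - Disk.cx d) * (toℚ x - Disk.cx d)) + ((toℚ y - Disk.cy d) * (toℚ y - Disk.cy d))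
    ℚ.≤ (Disk.r d * Disk.r d)

Separates : Disk → Point → Point → Set
Separates d p q = (Covers d p × ¬ Covers d q) ⊎ (Covers d q × ¬ Covers d p)

InGrid : ℕ → ℕ → Point → Set
InGrid m n (x , y) = (1 ≤ x × x ≤ n) × (1 ≤ y × y ≤ m)

Identifies : ℕ → ℕ → List Disk → Set
Identifies m n D =
  (∀ p → InGrid m n p → Any (λ d → Covers d p) D) ×
  (∀ p q → InGrid m n p → InGrid m n q → ¬ (p ≡ q) → Any (λ d → Separates d p q) D)

-- The identifying family consists of m − 1 row disks and k = ⌈n/2⌉ column disks.
-- Row disks have their centres about n² above or below the grid, so on the grid they act like
-- half-planes: one covers the rows y ≥ 2, the others the rows y ≤ g for 2 ≤ g ≤ m − 1. Together
-- they cover the grid and separate any two points lying in different rows.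
-- Column disk i < k is centred in the middle of the block of columns i + 1, …, i + k and meets
-- the grid exactly in that block as long as (m − 1)² + 2 ≤ 4k; as n ≤ 2k, these windows separate
-- any two points of a common row. The proviso follows from m² ≤ 2n + 6 except when m = 3 and
-- n = 2, where a single off-centre disk containing column 1 but not column 2 does the job.

module Submission where

open import Defs
open import Data.Nat using (ℕ; _≤_; _+_; _*_; _∸_; ⌈_/2⌉)
open import Data.Product using (∃; _×_)
open import Data.List using (List; length)

open import Data.Nat as ℕ using (suc; zero; _<_; NonZero; ∣_-_∣; pred; z≤n; s≤s; ⌊_/2⌋)
import Data.Nat.Properties as ℕP
open import Data.Nat.Tactic.RingSolver using (solve-∀)
open import Data.Integer as ℤ using (ℤ; +_; -[1+_])
import Data.Integer.Properties as ℤP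
open import Data.Integer.Tactic.RingSolver renaming (solve-∀ to ℤ-solve-∀)
import Data.Rational as ℚ
import Data.Rational.Properties as ℚP
import Data.Rational.Unnormalised as ℚᵘ
open ℚᵘ using (mkℚᵘ; *≤*; *≡*)
import Data.Rational.Unnormalised.Properties as ℚᵘP
open import Data.Product using (_,_)
open import Data.Sum as Sum using (_⊎_; inj₁; inj₂)
open import Data.Empty using (⊥-elim)
open import Data.List using ([]; _∷_; _++_; applyUpTo)
open import Data.List.Properties using (length-++; length-applyUpTo)
open import Data.List.Relation.Unary.Any as Any using (Any; here; there)
open import Data.List.Relation.Unary.Any.Properties using (++⁺ˡ; ++⁺ʳ)
open import Data.List.Membership.Propositional using (_∈_; lose)
open import Data.List.Membership.Propositional.Properties using (∈-applyUpTo⁺)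
open import Function using (_∘_; _⇔_; mk⇔; Equivalence)
open import Function.Properties.Equivalence using () renaming (trans to ⇔-trans)
open import Relation.Nullary using (¬_; Dec; yes; no)
open import Relation.Nullary.Decidable using (from-yes)
open import Relation.Binary using (Tri; tri<; tri≈; tri>)
open import Relation.Binary.PropositionalEquality

∣+m-+n∣≡∣m-n∣ : ∀ m n → ℤ.∣ + m ℤ.- + n ∣ ≡ ∣ m - n ∣
∣+m-+n∣≡∣m-n∣ m n with ℕP.≤-total m n
... | inj₁ m≤n = begin
  ℤ.∣ + m ℤ.- + n ∣ ≡⟨ cong ℤ.∣_∣ (ℤP.m-n≡m⊖n m n) ⟩
  ℤ.∣ m ℤ.⊖ n ∣     ≡⟨ ℤP.∣⊖∣-≤ m≤n ⟩
  n ∸ m             ≡⟨ ℕP.m≤n⇒∣m-n∣≡n∸m m≤n ⟨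
  ∣ m - n ∣         ∎
  where open ≡-Reasoning
... | inj₂ n≤m = begin
  ℤ.∣ + m ℤ.- + n ∣ ≡⟨ cong ℤ.∣_∣ (ℤP.m-n≡m⊖n m n) ⟩
  ℤ.∣ m ℤ.⊖ n ∣     ≡⟨ ℤP.∣m⊖n∣≡∣n⊖m∣ m n ⟩
  ℤ.∣ n ℤ.⊖ m ∣     ≡⟨ ℤP.∣⊖∣-≤ n≤m ⟩
  m ∸ n             ≡⟨ ℕP.m≤n⇒∣n-m∣≡n∸m n≤m ⟨
  ∣ m - n ∣         ∎
  where open ≡-Reasoning

m≤n⇒∣m-n∣<o : ∀ {m n o} → m ≤ n → n < m + o → ∣ m - n ∣ < o
m≤n⇒∣m-n∣<o {m} {n} {o} m≤n n<m+o = ℕP.+-cancelˡ-< m _ o (begin-strict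
  m + ∣ m - n ∣ ≡⟨ cong (_+_ m) (ℕP.m≤n⇒∣m-n∣≡n∸m m≤n) ⟩
  m + (n ∸ m)   ≡⟨ ℕP.m+[n∸m]≡n m≤n ⟩
  n             <⟨ n<m+o ⟩
  m + o         ∎)
  where open ℕP.≤-Reasoning

∣m-n∣<o : ∀ {m n o} → m < n + o → n < m + o → ∣ m - n ∣ < o
∣m-n∣<o {m} {n} m<n+o n<m+o with ℕP.≤-total m n
... | inj₁ m≤n = m≤n⇒∣m-n∣<o m≤n n<m+o
... | inj₂ n≤m = subst (_< _) (ℕP.∣-∣-comm n m) (m≤n⇒∣m-n∣<o n≤m m<n+o)

m+o≤n⇒o≤∣m-n∣ : ∀ m n {o} → m + o ≤ n → o ≤ ∣ m - n ∣
m+o≤n⇒o≤∣m-n∣ m n {o} h = ℕP.+-cancelˡ-≤ m o _ (ℕP.≤-trans h (ℕP.m≤n+∣n-m∣ n m))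

n+o≤m⇒o≤∣m-n∣ : ∀ m n {o} → n + o ≤ m → o ≤ ∣ m - n ∣
n+o≤m⇒o≤∣m-n∣ m n h = subst (_ ≤_) (ℕP.∣-∣-comm n m) (m+o≤n⇒o≤∣m-n∣ n m h)

Within : ℕ → ℕ → ℕ → Set
Within u v r = u * u + v * v ≤ r * r

near⇒Within : ∀ {u v r} → v < r → u * u ≤ 2 * v + 1 → Within u v r
near⇒Within {u} {v} {r} v<r u²≤2v+1 = begin
  u * u + v * v         ≤⟨ ℕP.+-monoˡ-≤ (v * v) u²≤2v+1 ⟩
  2 * v + 1 + v * v     ≡⟨ square-suc v ⟩
  suc v * suc v         ≤⟨ ℕP.*-mono-≤ v<r v<r ⟩
  r * r                 ∎
  where
  open ℕP.≤-Reasoning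
  square-suc : ∀ v → 2 * v + 1 + v * v ≡ suc v * suc v
  square-suc = solve-∀

r<v⇒¬Within : ∀ {u v r} → r < v → ¬ Within u v r
r<v⇒¬Within {u} {v} r<v h = ℕP.<⇒≱ (ℕP.<-≤-trans (ℕP.*-mono-< r<v r<v) (ℕP.m≤n+m (v * v) (u * u))) h

r<u⇒¬Within : ∀ {u v r} → r < u → ¬ Within u v r
r<u⇒¬Within {u} {v} r<u h = ℕP.<⇒≱ (ℕP.<-≤-trans (ℕP.*-mono-< r<u r<u) (ℕP.m≤m+n (u * u) (v * v))) h

Within-k[2+k] : ∀ {k u v} → u < k → v * v + 2 ≤ 4 * k → Within (suc k * u) (suc k * v) (k * (2 + k))
Within-k[2+k] {suc w} {u} {v} (s≤s u≤w) v²+2≤4k = ℕP.+-cancelʳ-≤ (2 * (K * K)) _ _ (begin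
  K * u * (K * u) + K * v * (K * v) + 2 * (K * K) ≡⟨ factor K u v ⟩
  K * K * (u * u + (v * v + 2))                   ≤⟨ ℕP.*-monoʳ-≤ (K * K) (ℕP.+-mono-≤ u²≤w² v²+2≤4k) ⟩
  K * K * (w * w + 4 * suc w)                     ≤⟨ ℕP.n≤1+n _ ⟩
  suc (K * K * (w * w + 4 * suc w))               ≡⟨ expand w ⟩
  k * (2 + k) * (k * (2 + k)) + 2 * (K * K)       ∎)
  where
  open ℕP.≤-Reasoning
  k = suc w
  K = suc k
  factor : ∀ K u v → K * u * (K * u) + K * v * (K * v) + 2 * (K * K) ≡ K * K * (u * u + (v * v + 2))
  factor = solve-∀
  u²≤w² : u * u ≤ w * w
  u²≤w² = ℕP.*-mono-≤ u≤w u≤w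
  -- k (2 + k) = K² − 1 and w² + 4 (w + 1) = K², so the bound K⁴ is just below (K² − 1)² + 2K² = K⁴ + 1.
  expand : ∀ w → suc ((2 + w) * (2 + w) * (w * w + 4 * suc w))
               ≡ suc w * (2 + suc w) * (suc w * (2 + suc w)) + 2 * ((2 + w) * (2 + w))
  expand = solve-∀

k[2+k]<[1+k]² : ∀ k → k * (2 + k) < suc k * suc k
k[2+k]<[1+k]² k = ℕP.≤-reflexive (eq k)
  where
  eq : ∀ k → suc (k * (2 + k)) ≡ suc k * suc k
  eq = solve-∀

scaledDisk : (a b : ℤ) (r q : ℕ) .{{_ : NonZero r}} .{{_ : NonZero q}} → Disk
scaledDisk a b r q = disk (a ℚ./ q) (b ℚ./ q) (+ r ℚ./ q) (ℚP.positive⁻¹ _ {{ℚP.normalize-pos r q}})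

toℚᵘ-/ : ∀ i n .{{_ : NonZero n}} → ℚ.toℚᵘ (i ℚ./ n) ℚᵘ.≃ i ℚᵘ./ n
toℚᵘ-/ i (suc d) = ℚP.toℚᵘ-fromℚᵘ (mkℚᵘ i d)

toℚᵘ-offset : ∀ x a q .{{_ : NonZero q}} → ℚ.toℚᵘ (toℚ x ℚ.- a ℚ./ q) ℚᵘ.≃ (+ (q * x) ℤ.- a) ℚᵘ./ q
toℚᵘ-offset x a q@(suc _) = begin
  ℚ.toℚᵘ (toℚ x ℚ.- a ℚ./ q)                   ≈⟨ ℚP.toℚᵘ-homo-+ (toℚ x) (ℚ.- (a ℚ./ q)) ⟩
  ℚ.toℚᵘ (toℚ x) ℚᵘ.+ ℚ.toℚᵘ (ℚ.- (a ℚ./ q))   ≈⟨ ℚᵘP.+-cong (toℚᵘ-/ (+ x) 1) toℚᵘ-[-a/q] ⟩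
  (+ x ℚᵘ./ 1) ℚᵘ.- (a ℚᵘ./ q)                 ≈⟨ *≡* crossMultiplied ⟩
  (+ (q * x) ℤ.- a) ℚᵘ./ q                     ∎
  where
  open ℚᵘP.≃-Reasoning
  toℚᵘ-[-a/q] : ℚ.toℚᵘ (ℚ.- (a ℚ./ q)) ℚᵘ.≃ ℚᵘ.- (a ℚᵘ./ q)
  toℚᵘ-[-a/q] = ℚᵘP.≃-trans (ℚP.toℚᵘ-homo‿- (a ℚ./ q)) (ℚᵘP.-‿cong (toℚᵘ-/ a q))
  rearrange : ∀ X Q A → (X ℤ.* Q ℤ.+ ℤ.- A ℤ.* + 1) ℤ.* Q ≡ (Q ℤ.* X ℤ.- A) ℤ.* Q
  rearrange = ℤ-solve-∀
  crossMultiplied : (+ x ℤ.* + q ℤ.+ ℤ.- a ℤ.* + 1) ℤ.* + q ≡ (+ (q * x) ℤ.- a) ℤ.* + (1 * q)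
  crossMultiplied = trans (rearrange (+ x) (+ q) a)
    (cong₂ (λ u v → (u ℤ.- a) ℤ.* + v) (sym (ℤP.pos-* q x)) (sym (ℕP.*-identityˡ q)))

sumOfSquares-≤⇔ : ∀ X Y R q .{{_ : NonZero q}} →
  ((X ℚᵘ./ q) ℚᵘ.* (X ℚᵘ./ q) ℚᵘ.+ (Y ℚᵘ./ q) ℚᵘ.* (Y ℚᵘ./ q) ℚᵘ.≤ (R ℚᵘ./ q) ℚᵘ.* (R ℚᵘ./ q))
    ⇔ (X ℤ.* X ℤ.+ Y ℤ.* Y ℤ.≤ R ℤ.* R)
sumOfSquares-≤⇔ X Y R q@(suc _) = mk⇔
  (λ { (*≤* h) → ℤP.*-cancelʳ-≤-pos _ _ (+ (q² * q²)) (subst (ℤ._≤ R ℤ.* R ℤ.* + (q² * q²)) lhs≡ h) })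
  (λ h → *≤* (subst (ℤ._≤ R ℤ.* R ℤ.* + (q² * q²)) (sym lhs≡) (ℤP.*-monoʳ-≤-nonNeg (+ (q² * q²)) h)))
  where
  q² = q * q
  factor : ∀ A B D → (A ℤ.* D ℤ.+ B ℤ.* D) ℤ.* D ≡ (A ℤ.+ B) ℤ.* (D ℤ.* D)
  factor = ℤ-solve-∀
  lhs≡ : (X ℤ.* X ℤ.* + q² ℤ.+ Y ℤ.* Y ℤ.* + q²) ℤ.* + q² ≡ (X ℤ.* X ℤ.+ Y ℤ.* Y) ℤ.* + (q² * q²)
  lhs≡ = trans (factor (X ℤ.* X) (Y ℤ.* Y) (+ q²)) (cong ((X ℤ.* X ℤ.+ Y ℤ.* Y) ℤ.*_) (sym (ℤP.pos-* q² q²)))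

i*i≡∣i∣*∣i∣ : ∀ i → i ℤ.* i ≡ + (ℤ.∣ i ∣ * ℤ.∣ i ∣)
i*i≡∣i∣*∣i∣ (+ n)    = sym (ℤP.pos-* n n)
i*i≡∣i∣*∣i∣ -[1+ n ] = refl

sumOfSquares-≤⇔Within : ∀ X Y r → (X ℤ.* X ℤ.+ Y ℤ.* Y ℤ.≤ + r ℤ.* + r) ⇔ Within ℤ.∣ X ∣ ℤ.∣ Y ∣ r
sumOfSquares-≤⇔Within X Y r = mk⇔
  (λ h → ℤP.drop‿+≤+ (subst₂ ℤ._≤_ lhs≡ (sym (ℤP.pos-* r r)) h))
  (λ h → subst₂ ℤ._≤_ (sym lhs≡) (ℤP.pos-* r r) (ℤ.+≤+ h))
  where
  lhs≡ : X ℤ.* X ℤ.+ Y ℤ.* Y ≡ + (ℤ.∣ X ∣ * ℤ.∣ X ∣ + ℤ.∣ Y ∣ * ℤ.∣ Y ∣)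
  lhs≡ = trans (cong₂ ℤ._+_ (i*i≡∣i∣*∣i∣ X) (i*i≡∣i∣*∣i∣ Y))
    (sym (ℤP.pos-+ (ℤ.∣ X ∣ * ℤ.∣ X ∣) (ℤ.∣ Y ∣ * ℤ.∣ Y ∣)))

scaledDisk-covers⇔ : ∀ a b r q .{{_ : NonZero r}} .{{_ : NonZero q}} x y →
  Covers (scaledDisk a b r q) (x , y) ⇔ Within ℤ.∣ + (q * x) ℤ.- a ∣ ℤ.∣ + (q * y) ℤ.- b ∣ r
scaledDisk-covers⇔ a b r q x y =
  ⇔-trans (mk⇔ ℚP.toℚᵘ-mono-≤ ℚP.toℚᵘ-cancel-≤) (⇔-trans (≤-resp-≃ lhs≃ rhs≃)
    (⇔-trans (sumOfSquares-≤⇔ X Y (+ r) q) (sumOfSquares-≤⇔Within X Y r)))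
  where
  ≤-resp-≃ : ∀ {p p' s s'} → p ℚᵘ.≃ p' → s ℚᵘ.≃ s' → (p ℚᵘ.≤ s) ⇔ (p' ℚᵘ.≤ s')
  ≤-resp-≃ p≃p' s≃s' = mk⇔ (ℚᵘP.≤-respʳ-≃ s≃s' ∘ ℚᵘP.≤-respˡ-≃ p≃p')
    (ℚᵘP.≤-respʳ-≃ (ℚᵘP.≃-sym s≃s') ∘ ℚᵘP.≤-respˡ-≃ (ℚᵘP.≃-sym p≃p'))
  X = + (q * x) ℤ.- a
  Y = + (q * y) ℤ.- b
  dx = toℚ x ℚ.- a ℚ./ q
  dy = toℚ y ℚ.- b ℚ./ q
  toℚᵘ-square : ∀ p p' → ℚ.toℚᵘ p ℚᵘ.≃ p' → ℚ.toℚᵘ (p ℚ.* p) ℚᵘ.≃ p' ℚᵘ.* p'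
  toℚᵘ-square p p' h = ℚᵘP.≃-trans (ℚP.toℚᵘ-homo-* p p) (ℚᵘP.*-cong h h)
  lhs≃ : ℚ.toℚᵘ (dx ℚ.* dx ℚ.+ dy ℚ.* dy)
         ℚᵘ.≃ (X ℚᵘ./ q) ℚᵘ.* (X ℚᵘ./ q) ℚᵘ.+ (Y ℚᵘ./ q) ℚᵘ.* (Y ℚᵘ./ q)
  lhs≃ = ℚᵘP.≃-trans (ℚP.toℚᵘ-homo-+ (dx ℚ.* dx) (dy ℚ.* dy))
    (ℚᵘP.+-cong (toℚᵘ-square dx _ (toℚᵘ-offset x a q)) (toℚᵘ-square dy _ (toℚᵘ-offset y b q)))
  rhs≃ : ℚ.toℚᵘ ((+ r ℚ./ q) ℚ.* (+ r ℚ./ q)) ℚᵘ.≃ (+ r ℚᵘ./ q) ℚᵘ.* (+ r ℚᵘ./ q)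
  rhs≃ = toℚᵘ-square (+ r ℚ./ q) _ (toℚᵘ-/ (+ r) q)

rowDisk : ℤ → (r : ℕ) .{{_ : NonZero r}} → Disk
rowDisk b r = scaledDisk (+ 0) b r 2

rowDisk-covers : ∀ b r .{{_ : NonZero r}} x y → ℤ.∣ + (2 * y) ℤ.- b ∣ < r →
  (2 * x) * (2 * x) ≤ 2 * ℤ.∣ + (2 * y) ℤ.- b ∣ + 1 → Covers (rowDisk b r) (x , y)
rowDisk-covers b r x y v<r u²≤2v+1 = Equivalence.from (scaledDisk-covers⇔ (+ 0) b r 2 x y)
  (subst (λ u → Within u v r) (sym (cong ℤ.∣_∣ (ℤP.+-identityʳ (+ (2 * x))))) (near⇒Within {2 * x} v<r u²≤2v+1))
  where
  v = ℤ.∣ + (2 * y) ℤ.- b ∣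

rowDisk-¬covers : ∀ b r .{{_ : NonZero r}} x y → r < ℤ.∣ + (2 * y) ℤ.- b ∣ → ¬ Covers (rowDisk b r) (x , y)
rowDisk-¬covers b r x y r<v =
  r<v⇒¬Within {ℤ.∣ + (2 * x) ℤ.- + 0 ∣} r<v ∘ Equivalence.to (scaledDisk-covers⇔ (+ 0) b r 2 x y)

[2x]²≤2v+1 : ∀ {x n v} → x ≤ n → 2 * (n * n) ≤ v → (2 * x) * (2 * x) ≤ 2 * v + 1
[2x]²≤2v+1 {x} {n} {v} x≤n 2n²≤v = begin
  (2 * x) * (2 * x) ≡⟨ eq x ⟩
  2 * (2 * (x * x)) ≤⟨ ℕP.*-monoʳ-≤ 2 (ℕP.≤-trans (ℕP.*-monoʳ-≤ 2 (ℕP.*-mono-≤ x≤n x≤n)) 2n²≤v) ⟩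
  2 * v             ≤⟨ ℕP.m≤m+n (2 * v) 1 ⟩
  2 * v + 1         ∎
  where
  open ℕP.≤-Reasoning
  eq : ∀ x → (2 * x) * (2 * x) ≡ 2 * (2 * (x * x))
  eq = solve-∀

-- The centres lie about n² away from the grid, which makes the horizontal offset of a point with
-- x ≤ n negligible ([2x]²≤2v+1): aboveDisk n top covers the rows 2, …, top of the grid and
-- belowDisk n g the rows 1, …, g.
aboveDisk : ℕ → ℕ → Disk
aboveDisk n top = rowDisk (+ (2 * (top + n * n) + 5)) (2 * suc (top + n * n))

belowDisk : ℕ → ℕ → Disk
belowDisk n g = rowDisk -[1+ 2 * (n * n) ] (2 * suc (g + n * n))

aboveDisk-covers : ∀ {n top x y} → x ≤ n → 2 ≤ y → y ≤ top → Covers (aboveDisk n top) (x , y)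
aboveDisk-covers {n} {top} {x} {y} x≤n 2≤y y≤top = rowDisk-covers (+ b) r x y
  (subst (_< r) (sym (∣+m-+n∣≡∣m-n∣ (2 * y) b)) (∣m-n∣<o 2y<b+r b<2y+r))
  ([2x]²≤2v+1 x≤n (subst (2 * T ≤_) (sym (∣+m-+n∣≡∣m-n∣ (2 * y) b)) (m+o≤n⇒o≤∣m-n∣ (2 * y) b 2y+2T≤b)))
  where
  open ℕP.≤-Reasoning
  T = n * n
  b = 2 * (top + T) + 5
  r = 2 * suc (top + T)
  2y≤2[top+T] : 2 * y ≤ 2 * (top + T)
  2y≤2[top+T] = ℕP.*-monoʳ-≤ 2 (ℕP.m≤n⇒m≤n+o T y≤top)
  2y<b+r : 2 * y < b + r
  2y<b+r = begin-strict
    2 * y         ≤⟨ 2y≤2[top+T] ⟩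
    2 * (top + T) <⟨ ℕP.m<m+n (2 * (top + T)) (s≤s z≤n) ⟩
    b             ≤⟨ ℕP.m≤m+n b r ⟩
    b + r         ∎
  b<2y+r : b < 2 * y + r
  b<2y+r = begin-strict
    b         <⟨ ℕP.n<1+n b ⟩
    suc b     ≡⟨ eq top T ⟩
    2 * 2 + r ≤⟨ ℕP.+-monoˡ-≤ r (ℕP.*-monoʳ-≤ 2 2≤y) ⟩
    2 * y + r ∎
    where
    eq : ∀ top T → suc (2 * (top + T) + 5) ≡ 2 * 2 + 2 * suc (top + T)
    eq = solve-∀
  2y+2T≤b : 2 * y + 2 * T ≤ b
  2y+2T≤b = begin
    2 * y + 2 * T       ≤⟨ ℕP.+-monoˡ-≤ (2 * T) (ℕP.*-monoʳ-≤ 2 y≤top) ⟩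
    2 * top + 2 * T     ≡⟨ ℕP.*-distribˡ-+ 2 top T ⟨
    2 * (top + T)       ≤⟨ ℕP.m≤m+n _ 5 ⟩
    b                   ∎

aboveDisk-¬covers : ∀ n top x → ¬ Covers (aboveDisk n top) (x , 1)
aboveDisk-¬covers n top x = rowDisk-¬covers (+ b) r x 1
  (subst (r <_) (sym (∣+m-+n∣≡∣m-n∣ 2 b)) (m+o≤n⇒o≤∣m-n∣ 2 b (ℕP.≤-reflexive (eq top (n * n)))))
  where
  b = 2 * (top + n * n) + 5
  r = 2 * suc (top + n * n)
  eq : ∀ top T → 2 + suc (2 * suc (top + T)) ≡ 2 * (top + T) + 5
  eq = solve-∀

belowDisk-covers : ∀ {n g x y} → x ≤ n → y ≤ g → Covers (belowDisk n g) (x , y)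
belowDisk-covers {n} {g} {x} {y} x≤n y≤g = rowDisk-covers -[1+ 2 * T ] (2 * suc (g + T)) x y
  (begin-strict
    2 * y + suc (2 * T) ≤⟨ ℕP.+-monoˡ-≤ _ (ℕP.*-monoʳ-≤ 2 y≤g) ⟩
    2 * g + suc (2 * T) <⟨ ℕP.≤-reflexive (eq g T) ⟩
    2 * suc (g + T)     ∎)
  ([2x]²≤2v+1 x≤n (ℕP.≤-trans (ℕP.n≤1+n (2 * T)) (ℕP.m≤n+m (suc (2 * T)) (2 * y))))
  where
  open ℕP.≤-Reasoning
  T = n * n
  eq : ∀ g T → suc (2 * g + suc (2 * T)) ≡ 2 * suc (g + T)
  eq = solve-∀

belowDisk-¬covers : ∀ n {g} x y → g < y → ¬ Covers (belowDisk n g) (x , y)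
belowDisk-¬covers n {g} x y g<y = rowDisk-¬covers -[1+ 2 * T ] (2 * suc (g + T)) x y (begin-strict
  2 * suc (g + T)       <⟨ ℕP.≤-reflexive (eq g T) ⟩
  2 * suc g + suc (2 * T) ≤⟨ ℕP.+-monoˡ-≤ _ (ℕP.*-monoʳ-≤ 2 g<y) ⟩
  2 * y + suc (2 * T)   ∎)
  where
  open ℕP.≤-Reasoning
  T = n * n
  eq : ∀ g T → suc (2 * suc (g + T)) ≡ 2 * suc g + suc (2 * T)
  eq = solve-∀

∣2x-[2i+1+w]∣<w : ∀ {i w x} → i < x → x ≤ i + w → ∣ 2 * x - (2 * i + suc w) ∣ < w
∣2x-[2i+1+w]∣<w {i} {w} {x} i<x x≤i+w = ∣m-n∣<o
  (begin-strict
    2 * x               ≤⟨ ℕP.*-monoʳ-≤ 2 x≤i+w ⟩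
    2 * (i + w)         <⟨ ℕP.≤-reflexive (right i w) ⟩
    2 * i + suc w + w   ∎)
  (begin-strict
    2 * i + suc w       <⟨ ℕP.≤-reflexive (left i w) ⟩
    2 * suc i + w       ≤⟨ ℕP.+-monoˡ-≤ w (ℕP.*-monoʳ-≤ 2 i<x) ⟩
    2 * x + w           ∎)
  where
  open ℕP.≤-Reasoning
  right : ∀ i w → suc (2 * (i + w)) ≡ 2 * i + suc w + w
  right = solve-∀
  left : ∀ i w → suc (2 * i + suc w) ≡ 2 * suc i + w
  left = solve-∀

1+w≤∣2x-[2i+1+w]∣ : ∀ {i w x} → x ≤ i ⊎ i + suc w ≤ x → suc w ≤ ∣ 2 * x - (2 * i + suc w) ∣
1+w≤∣2x-[2i+1+w]∣ {i} {w} {x} (inj₁ x≤i) =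
  m+o≤n⇒o≤∣m-n∣ (2 * x) _ (ℕP.+-monoˡ-≤ (suc w) (ℕP.*-monoʳ-≤ 2 x≤i))
1+w≤∣2x-[2i+1+w]∣ {i} {w} {x} (inj₂ i+1+w≤x) =
  n+o≤m⇒o≤∣m-n∣ (2 * x) _ (ℕP.≤-trans (ℕP.≤-reflexive (eq i w)) (ℕP.*-monoʳ-≤ 2 i+1+w≤x))
  where
  eq : ∀ i w → 2 * i + suc w + suc w ≡ 2 * (i + suc w)
  eq = solve-∀

-- Centre ((2i + k + 1)/2, (m + 1)/2) and radius k(k + 2)/(2(k + 1)); among the points of the
-- rows 1, …, m it contains exactly those in the columns i + 1, …, i + k.
columnDisk : (k i m : ℕ) .{{_ : NonZero k}} → Disk
columnDisk k i m = scaledDisk (+ (suc k * (2 * i + suc k))) (+ (suc k * suc m)) (k * (2 + k)) (2 * suc k)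
  {{ℕP.m*n≢0 k (2 + k)}}

columnDisk-offset : ∀ K x c → ℤ.∣ + (2 * K * x) ℤ.- + (K * c) ∣ ≡ K * ∣ 2 * x - c ∣
columnDisk-offset K x c = begin
  ℤ.∣ + (2 * K * x) ℤ.- + (K * c) ∣ ≡⟨ ∣+m-+n∣≡∣m-n∣ (2 * K * x) (K * c) ⟩
  ∣ 2 * K * x - K * c ∣             ≡⟨ cong (λ z → ∣ z - K * c ∣) (swap K x) ⟩
  ∣ K * (2 * x) - K * c ∣           ≡⟨ ℕP.*-distribˡ-∣-∣ K (2 * x) c ⟨
  K * ∣ 2 * x - c ∣                 ∎
  where
  open ≡-Reasoning
  swap : ∀ K x → 2 * K * x ≡ K * (2 * x)
  swap = solve-∀

columnDisk-covers⇔ : ∀ {k i m} .{{_ : NonZero k}} x y → Covers (columnDisk k i m) (x , y) ⇔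
  Within (suc k * ∣ 2 * x - (2 * i + suc k) ∣) (suc k * ∣ 2 * y - suc m ∣) (k * (2 + k))
columnDisk-covers⇔ {k} {i} {m} x y =
  subst₂ (λ u v → Covers (columnDisk k i m) (x , y) ⇔ Within u v (k * (2 + k)))
    (columnDisk-offset (suc k) x _) (columnDisk-offset (suc k) y _)
    (scaledDisk-covers⇔ (+ (suc k * (2 * i + suc k))) (+ (suc k * suc m)) (k * (2 + k)) (2 * suc k) {{ℕP.m*n≢0 k (2 + k)}} x y)

columnDisk-covers : ∀ {k i m x y} .{{_ : NonZero k}} → pred m * pred m + 2 ≤ 4 * k →
  i < x → x ≤ i + k → 0 < y → y ≤ m → Covers (columnDisk k i m) (x , y)
columnDisk-covers {k} {i} {m} {x} {y} h i<x x≤i+k 0<y y≤m =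
  Equivalence.from (columnDisk-covers⇔ {k} {i} {m} x y) (Within-k[2+k] {v = v} (∣2x-[2i+1+w]∣<w i<x x≤i+k) v²+2≤4k)
  where
  v = ∣ 2 * y - suc m ∣
  v≤pred-m : v ≤ pred m
  v≤pred-m = ℕP.<⇒≤pred (∣2x-[2i+1+w]∣<w {0} 0<y y≤m)
  v²+2≤4k : v * v + 2 ≤ 4 * k
  v²+2≤4k = ℕP.≤-trans (ℕP.+-monoˡ-≤ 2 (ℕP.*-mono-≤ v≤pred-m v≤pred-m)) h

columnDisk-¬covers : ∀ {k x} i m y .{{_ : NonZero k}} → x ≤ i ⊎ i + suc k ≤ x → ¬ Covers (columnDisk k i m) (x , y)
columnDisk-¬covers {k} {x} i m y outside =
  r<u⇒¬Within {v = suc k * ∣ 2 * y - suc m ∣}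
    (ℕP.<-≤-trans (k[2+k]<[1+k]² k) (ℕP.*-monoʳ-≤ (suc k) (1+w≤∣2x-[2i+1+w]∣ outside)))
  ∘ Equivalence.to (columnDisk-covers⇔ {k} {i} {m} x y)

SeparatesColumns : List Disk → ℕ → ℕ → Set
SeparatesColumns D m n = ∀ {x x' y} → 0 < x → x < x' → x' ≤ n → 0 < y → y ≤ m →
  Any (λ d → Separates d (x , y) (x' , y)) D

columnDisks : (k m : ℕ) .{{_ : NonZero k}} → List Disk
columnDisks k m = applyUpTo (λ i → columnDisk k i m) k

columnDisk∈columnDisks : ∀ {k i} m .{{_ : NonZero k}} → i < k → columnDisk k i m ∈ columnDisks k m
columnDisk∈columnDisks {k} m = ∈-applyUpTo⁺ (λ i → columnDisk k i m)

columnDisks-separate : ∀ {k m n} .{{_ : NonZero k}} → n ≤ 2 * k → pred m * pred m + 2 ≤ 4 * k →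
  SeparatesColumns (columnDisks k m) m n
columnDisks-separate {k} {m} {n} n≤2k h {x} {x'} {y} 0<x x<x' x'≤n 0<y y≤m = separate (x ℕ.<? k) (x' ℕ.≤? x + k)
  where
  separate : Dec (x < k) → Dec (x' ≤ x + k) → Any (λ d → Separates d (x , y) (x' , y)) (columnDisks k m)
  separate (yes x<k) (yes x'≤x+k) = lose (columnDisk∈columnDisks m x<k)
    (inj₂ (columnDisk-covers h x<x' x'≤x+k 0<y y≤m , columnDisk-¬covers x m y (inj₁ ℕP.≤-refl)))
  separate (yes x<k) (no x'≰x+k) = lose (columnDisk∈columnDisks m (ℕ.>-nonZero⁻¹ k))
    (inj₁ (columnDisk-covers h 0<x (ℕP.<⇒≤ x<k) 0<y y≤m ,
           columnDisk-¬covers 0 m y (inj₂ (ℕP.≤-trans (s≤s (ℕP.m≤n+m k x)) (ℕP.≰⇒> x'≰x+k)))))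
  separate (no x≮k) _ = lose (columnDisk∈columnDisks m i<k)
    (inj₁ (columnDisk-covers h i<x (ℕP.≤-reflexive (sym i+k≡x)) 0<y y≤m , columnDisk-¬covers i m y (inj₂ i+1+k≤x')))
    where
    k≤x = ℕP.≮⇒≥ x≮k
    i = x ∸ k
    i+k≡x : i + k ≡ x
    i+k≡x = ℕP.m∸n+n≡m k≤x
    i<x : i < x
    i<x = ℕP.∸-monoʳ-< (ℕ.>-nonZero⁻¹ k) k≤x
    i<k : i < k
    i<k = ℕP.m<n+o⇒m∸n<o x k (ℕP.<-≤-trans x<x' (ℕP.≤-trans x'≤n (ℕP.≤-trans n≤2k 2k≡k+k)))
      where
      2k≡k+k : 2 * k ≤ k + k
      2k≡k+k = ℕP.≤-reflexive (cong (_+_ k) (ℕP.+-identityʳ k))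
    i+1+k≤x' : i + suc k ≤ x'
    i+1+k≤x' = subst (_≤ x') (sym (trans (ℕP.+-suc i k) (cong suc i+k≡x))) x<x'

specialDisk : Disk
specialDisk = scaledDisk -[1+ 3 ] (+ 4) 7 2

specialDisk-covers : ∀ {y} → 0 < y → y ≤ 3 → Covers specialDisk (1 , y)
specialDisk-covers {1} _ _ = Equivalence.from (scaledDisk-covers⇔ -[1+ 3 ] (+ 4) 7 2 1 1) (from-yes (40 ℕ.≤? 49))
specialDisk-covers {2} _ _ = Equivalence.from (scaledDisk-covers⇔ -[1+ 3 ] (+ 4) 7 2 1 2) (from-yes (36 ℕ.≤? 49))
specialDisk-covers {3} _ _ = Equivalence.from (scaledDisk-covers⇔ -[1+ 3 ] (+ 4) 7 2 1 3) (from-yes (40 ℕ.≤? 49))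
specialDisk-covers {suc (suc (suc (suc _)))} _ (s≤s (s≤s (s≤s ())))

specialDisk-¬covers : ∀ y → ¬ Covers specialDisk (2 , y)
specialDisk-¬covers y =
  r<u⇒¬Within {v = ℤ.∣ + (2 * y) ℤ.- + 4 ∣} (ℕP.n<1+n 7) ∘ Equivalence.to (scaledDisk-covers⇔ -[1+ 3 ] (+ 4) 7 2 2 y)

specialDisk-separates : SeparatesColumns (specialDisk ∷ []) 3 2
specialDisk-separates {y = y} (s≤s z≤n) (s≤s (s≤s z≤n)) (s≤s (s≤s z≤n)) 0<y y≤3 =
  here (inj₁ (specialDisk-covers 0<y y≤3 , specialDisk-¬covers y))

rowDisks : ℕ → ℕ → List Disk
rowDisks m n = aboveDisk n m ∷ applyUpTo (λ j → belowDisk n (2 + j)) (m ∸ 2)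

belowDisk∈rowDisks : ∀ m n {j} → j < m ∸ 2 → belowDisk n (2 + j) ∈ rowDisks m n
belowDisk∈rowDisks m n j<m∸2 = there (∈-applyUpTo⁺ (λ j → belowDisk n (2 + j)) j<m∸2)

length-rowDisks : ∀ {m} n → 2 ≤ m → length (rowDisks m n) ≡ m ∸ 1
length-rowDisks {suc (suc h)} n (s≤s (s≤s _)) = cong suc (length-applyUpTo _ h)

rowDisks-cover : ∀ {m n x y} → 3 ≤ m → x ≤ n → 0 < y → y ≤ m → Any (λ d → Covers d (x , y)) (rowDisks m n)
rowDisks-cover {m} {n} (s≤s (s≤s (s≤s _))) x≤n (s≤s {n = zero} _) _ =
  lose (belowDisk∈rowDisks m n (s≤s z≤n)) (belowDisk-covers {g = 2} x≤n (s≤s z≤n))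
rowDisks-cover _ x≤n (s≤s {n = suc _} _) y≤m = here (aboveDisk-covers x≤n (s≤s (s≤s z≤n)) y≤m)

rowDisks-separate : ∀ {m n x x' y y'} → x ≤ n → x' ≤ n → 0 < y → y < y' → y' ≤ m →
  Any (λ d → Separates d (x , y) (x' , y')) (rowDisks m n)
rowDisks-separate {m} {n} {x} {y = suc zero} x≤n x'≤n _ y<y' y'≤m =
  here (inj₂ (aboveDisk-covers x'≤n y<y' y'≤m , aboveDisk-¬covers n m x))
rowDisks-separate {m} {n} {x' = x'} {y = suc (suc y₀)} {y'} x≤n x'≤n _
                  y<y'@(s≤s (s≤s (s≤s _))) y'≤m@(s≤s (s≤s (s≤s _))) =
  lose (belowDisk∈rowDisks m n (ℕP.≤-pred (ℕP.≤-pred (ℕP.<-≤-trans y<y' y'≤m))))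
    (inj₁ (belowDisk-covers {g = suc (suc y₀)} x≤n ℕP.≤-refl , belowDisk-¬covers n x' y' y<y'))

rowDisks++-identifies : ∀ {m n cols} → 3 ≤ m → SeparatesColumns cols m n → Identifies m n (rowDisks m n ++ cols)
rowDisks++-identifies {m} {n} {cols} 3≤m separatesColumns = covered , separated
  where
  covered : ∀ p → InGrid m n p → Any (λ d → Covers d p) (rowDisks m n ++ cols)
  covered (x , y) ((_ , x≤n) , (0<y , y≤m)) = ++⁺ˡ (rowDisks-cover 3≤m x≤n 0<y y≤m)
  separated : ∀ p q → InGrid m n p → InGrid m n q → ¬ p ≡ q → Any (λ d → Separates d p q) (rowDisks m n ++ cols)
  separated (x , y) (x' , y') ((0<x , x≤n) , (0<y , y≤m)) ((0<x' , x'≤n) , (0<y' , y'≤m)) p≢q = byRow (ℕP.<-cmp y y')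
    where
    byRow : Tri (y < y') (y ≡ y') (y' < y) → Any (λ d → Separates d (x , y) (x' , y')) (rowDisks m n ++ cols)
    byRow (tri< y<y' _ _) = ++⁺ˡ (rowDisks-separate x≤n x'≤n 0<y y<y' y'≤m)
    byRow (tri> _ _ y'<y) = Any.map Sum.swap (++⁺ˡ (rowDisks-separate x'≤n x≤n 0<y' y'<y y≤m))
    byRow (tri≈ _ y≡y' _) = subst (λ y' → Any (λ d → Separates d (x , y) (x' , y')) (rowDisks m n ++ cols)) y≡y'
      (++⁺ʳ (rowDisks m n) (byColumn (ℕP.<-cmp x x')))
      where
      byColumn : Tri (x < x') (x ≡ x') (x' < x) → Any (λ d → Separates d (x , y) (x' , y)) cols
      byColumn (tri< x<x' _ _) = separatesColumns 0<x x<x' x'≤n 0<y y≤m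
      byColumn (tri> _ _ x'<x) = Any.map Sum.swap (separatesColumns 0<x' x'<x x≤n 0<y y≤m)
      byColumn (tri≈ _ x≡x' _) = ⊥-elim (p≢q (cong₂ _,_ x≡x' y≡y'))

length-rowDisks++ : ∀ {m} n cols → 2 ≤ m → length (rowDisks m n ++ cols) ≡ (length cols + m) ∸ 1
length-rowDisks++ {m} n cols 2≤m@(s≤s (s≤s _)) = begin
  length (rowDisks m n ++ cols)          ≡⟨ length-++ (rowDisks m n) ⟩
  length (rowDisks m n) + length cols    ≡⟨ cong (_+ length cols) (length-rowDisks n 2≤m) ⟩
  (m ∸ 1) + length cols                  ≡⟨ cong (_∸ 1) (ℕP.+-comm m (length cols)) ⟩
  (length cols + m) ∸ 1                  ∎
  where open ≡-Reasoning

n≤2⌈n/2⌉ : ∀ n → n ≤ 2 * ⌈ n /2⌉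
n≤2⌈n/2⌉ n = begin
  n                     ≡⟨ ℕP.⌊n/2⌋+⌈n/2⌉≡n n ⟨
  ⌊ n /2⌋ + ⌈ n /2⌉     ≤⟨ ℕP.+-monoˡ-≤ ⌈ n /2⌉ (ℕP.⌊n/2⌋≤⌈n/2⌉ n) ⟩
  ⌈ n /2⌉ + ⌈ n /2⌉     ≡⟨ cong (_+_ ⌈ n /2⌉) (ℕP.+-identityʳ ⌈ n /2⌉) ⟨
  2 * ⌈ n /2⌉           ∎
  where open ℕP.≤-Reasoning

3×2⊎columnsFit : ∀ m n → 3 ≤ m → m * m ≤ 2 * n + 6 →
  (m ≡ 3 × n ≡ 2) ⊎ pred m * pred m + 2 ≤ 4 * ⌈ n /2⌉
3×2⊎columnsFit 0 _ () _
3×2⊎columnsFit 1 _ (s≤s ()) _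
3×2⊎columnsFit 2 _ (s≤s (s≤s ())) _
3×2⊎columnsFit 3 0 _ h = ⊥-elim (ℕP.<⇒≱ (from-yes (6 ℕ.<? 9)) h)
3×2⊎columnsFit 3 1 _ h = ⊥-elim (ℕP.<⇒≱ (from-yes (8 ℕ.<? 9)) h)
3×2⊎columnsFit 3 2 _ _ = inj₁ (refl , refl)
3×2⊎columnsFit 3 n@(suc (suc (suc _))) _ _ =
  inj₂ (ℕP.≤-trans (from-yes (6 ℕ.≤? 8)) (ℕP.*-monoʳ-≤ 4 (ℕP.⌈n/2⌉-mono {3} {n} (s≤s (s≤s (s≤s z≤n))))))
3×2⊎columnsFit 4 n _ h = inj₂ (ℕP.≤-trans (from-yes (11 ℕ.≤? 12)) (ℕP.*-monoʳ-≤ 4 (ℕP.⌈n/2⌉-mono 5≤n)))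
  where
  5≤n : 5 ≤ n
  5≤n = ℕP.*-cancelˡ-≤ 2 (ℕP.+-cancelʳ-≤ 6 10 (2 * n) h)
3×2⊎columnsFit (suc (suc (suc (suc (suc r))))) n _ h = inj₂ (ℕP.+-cancelʳ-≤ 6 _ _ (begin
  (4 + r) * (4 + r) + 2 + 6 ≤⟨ ℕP.m≤m+n _ (1 + 2 * r) ⟩
  (4 + r) * (4 + r) + 2 + 6 + (1 + 2 * r) ≡⟨ square-next r ⟩
  (5 + r) * (5 + r)         ≤⟨ h ⟩
  2 * n + 6                 ≤⟨ ℕP.+-monoˡ-≤ 6 (ℕP.*-monoʳ-≤ 2 (n≤2⌈n/2⌉ n)) ⟩
  2 * (2 * ⌈ n /2⌉) + 6      ≡⟨ cong (_+ 6) (ℕP.*-assoc 2 2 ⌈ n /2⌉) ⟨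
  4 * ⌈ n /2⌉ + 6            ∎))
  where
  open ℕP.≤-Reasoning
  square-next : ∀ r → (4 + r) * (4 + r) + 2 + 6 + (1 + 2 * r) ≡ (5 + r) * (5 + r)
  square-next = solve-∀

identifyingFamily : ∀ m n .{{_ : NonZero ⌈ n /2⌉}} → 3 ≤ m → pred m * pred m + 2 ≤ 4 * ⌈ n /2⌉ →
  ∃ λ (D : List Disk) → length D ≤ (⌈ n /2⌉ + m) ∸ 1 × Identifies m n D
identifyingFamily m n 3≤m columnsFit =
  rowDisks m n ++ columnDisks k m ,
  ℕP.≤-reflexive (trans (length-rowDisks++ n _ (ℕP.<⇒≤ 3≤m)) (cong (λ l → (l + m) ∸ 1) (length-applyUpTo _ k))) ,
  rowDisks++-identifies 3≤m (columnDisks-separate (n≤2⌈n/2⌉ n) columnsFit)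
  where k = ⌈ n /2⌉

identifyingFamily-3×2 : ∃ λ (D : List Disk) → length D ≤ 3 × Identifies 3 2 D
identifyingFamily-3×2 = rowDisks 3 2 ++ specialDisk ∷ [] , ℕP.≤-refl , rowDisks++-identifies ℕP.≤-refl specialDisk-separates

theorem6 : (m n : ℕ) → 3 ≤ m → m * m ≤ 2 * n + 6 →
    ∃ λ (D : List Disk) → length D ≤ (⌈ n /2⌉ + m) ∸ 1 × Identifies m n D
theorem6 m zero 3≤m m²≤6 = ⊥-elim (ℕP.<⇒≱ (from-yes (6 ℕ.<? 9)) (ℕP.≤-trans (ℕP.*-mono-≤ 3≤m 3≤m) m²≤6))
theorem6 m n@(suc _) 3≤m m²≤2n+6 =
  Sum.[ (λ { (refl , refl) → identifyingFamily-3×2 }) , identifyingFamily m n 3≤m ]′ (3×2⊎columnsFit m n 3≤m m²≤2n+6)
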